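{- For every integer $k\ge 2$ there exists an integer $n_k$ such that for every admissible $n\ge n_k$ (that is, $n\ge 6$ and $n\equiv 0,1\pmod 3$), there exists a $k$-chromatic $3$-star system of order $n$.
   Context: An $e$-star is the complete bipartite graph $K_{1,e}$. An $e$-star system of order $n$ is a pair $(V,\mathcal B)$ where $|V|=n$ and $\mathcal B$ is a set of $e$-stars (subgraphs of the complete graph $K_n$ on $V$) whose edge sets partition the edge set of $K_n$. An $e$-star system is $k$-colourable if $V$ can be partitioned into $k$ sets (colour classes) such that no star in $\mathcal B$ has all its vertices in the same class; it is $k$-chromatic if it is $k$-colourable but not $(k-1)$-colourable. A $3$-star system of order $n$ exists iff $n\equiv 0,1\pmod 3$ and $n\ge 6$; such $n$ are called admissible. -}

module Defs where

open import Data.Nat using (ℕ; suc; _≤_; _∸_)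
open import Data.Nat.DivMod using (_%_)
open import Data.Fin using (Fin)
open import Data.Fin.Properties using (_≟_)
open import Data.List using (List; length; filter)
open import Data.List.Relation.Unary.All using (All)
open import Data.Product using (_×_; Σ; ∃)
open import Data.Sum using (_⊎_)
open import Relation.Nullary using (¬_; Dec)
open import Relation.Nullary.Decidable using (_⊎-dec_; _×-dec_)
open import Relation.Binary.PropositionalEquality using (_≡_; _≢_)

record Star3 (n : ℕ) : Set where
  constructor star
  field
    centre : Fin n
    leaf₁ leaf₂ leaf₃ : Fin n
    c≢1 : centre ≢ leaf₁
    c≢2 : centre ≢ leaf₂
    c≢3 : centre ≢ leaf₃
    1≢2 : leaf₁ ≢ leaf₂
    1≢3 : leaf₁ ≢ leaf₃
    2≢3 : leaf₂ ≢ leaf₃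

open Star3 public

edgeIs : ∀ {n} → Fin n → Fin n → Fin n → Fin n → Set
edgeIs c x u v = (u ≡ c × v ≡ x) ⊎ (u ≡ x × v ≡ c)

HasEdge : ∀ {n} → Star3 n → Fin n → Fin n → Set
HasEdge s u v = edgeIs (centre s) (leaf₁ s) u v
              ⊎ edgeIs (centre s) (leaf₂ s) u v
              ⊎ edgeIs (centre s) (leaf₃ s) u v

hasEdge? : ∀ {n} (s : Star3 n) (u v : Fin n) → Dec (HasEdge s u v)
hasEdge? s u v = e (leaf₁ s) ⊎-dec e (leaf₂ s) ⊎-dec e (leaf₃ s)
  where
  e : ∀ x → Dec (edgeIs (centre s) x u v)
  e x = ((u ≟ centre s) ×-dec (v ≟ x)) ⊎-dec ((u ≟ x) ×-dec (v ≟ centre s))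

edgeCount : ∀ {n} → List (Star3 n) → Fin n → Fin n → ℕ
edgeCount B u v = length (filter (λ s → hasEdge? s u v) B)

-- A 3-star system of order n: a collection of 3-stars whose edge sets
-- partition the edge set of K_n, i.e. every edge of K_n lies in exactly
-- one star of the collection.
IsStarSystem : (n : ℕ) → List (Star3 n) → Set
IsStarSystem n B = ∀ (u v : Fin n) → u ≢ v → edgeCount B u v ≡ 1

Monochromatic : ∀ {n k} → (Fin n → Fin k) → Star3 n → Set
Monochromatic col s =
  col (leaf₁ s) ≡ col (centre s) × col (leaf₂ s) ≡ col (centre s)
    × col (leaf₃ s) ≡ col (centre s)

-- a proper k-colouring: partition of the vertex set into k (possibly empty)
-- colour classes with no monochromatic star
Colourable : ∀ {n} → List (Star3 n) → ℕ → Set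
Colourable {n} B k = Σ (Fin n → Fin k) λ col → All (λ s → ¬ Monochromatic col s) B

Chromatic : ∀ {n} → List (Star3 n) → ℕ → Set
Chromatic B k = Colourable B k × ¬ Colourable B (k ∸ 1)

Admissible : ℕ → Set
Admissible n = 6 ≤ n × (n % 3 ≡ 0 ⊎ n % 3 ≡ 1)

-- A partitioned system is a properly coloured 3-star system together with a partition of its vertices
-- into non-monochromatic triples. Two systems on disjoint vertex sets can be glued along any set of stars
-- decomposing the complete bipartite graph between them. Joining uses, for every left vertex x and every
-- triple T on the right, the star from x to T. Attaching C to a triple t of W uses the stars from every
-- vertex of C to t and from every vertex of W outside t to the triples of C; recolouring C so that it
-- avoids the colour of t keeps the result proper. If C is not k-colourable, then no (k+1)-colouring of the
-- result makes t monochromatic, for otherwise C would avoid the colour of t. Attaching a (k+2)-chromatic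
-- system to every triple of a 2-coloured system on more than 2(k+2) vertices therefore gives a
-- (k+3)-chromatic system, since some three of those vertices share a colour. Finally, joining a
-- 2-colourable system of each admissible order to a (k+2)-chromatic partitioned system reaches every
-- large admissible order.
module Submission where

open import Defs
open import Data.Empty using (⊥-elim)
open import Data.Fin using (Fin; zero; suc; _↑ˡ_; _↑ʳ_; splitAt; punchIn; punchOut; _<_; #_)
open import Data.Fin.Properties
  using (_≟_; all?; any?; _<?_; <⇒≢; <-trans; pigeonhole; suc-injective; ↑ˡ-injective; ↑ʳ-injective;
         splitAt-↑ˡ; splitAt-↑ʳ; punchIn-injective; punchInᵢ≢i; punchOut-injective)
open import Data.List using (List; []; _∷_; [_]; _++_; map; length; filter; concat; tabulate)
open import Data.List.Properties using (filter-++; length-++; filter-none; filter-accept; filter-≐)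
open import Data.List.Relation.Unary.All as All using (All; []; _∷_)
open import Data.List.Relation.Unary.All.Properties
  using (++⁺; ++⁻ˡ; ++⁻ʳ; map⁺; map⁻; concat⁺; concat⁻; tabulate⁺; tabulate⁻; All¬⇒¬Any)
open import Data.List.Relation.Unary.Any using (Any; here)
import Data.List.Relation.Unary.Any.Properties as Any
import Data.Nat as ℕ
open import Data.Nat using (ℕ; _+_; _∸_; _≤_; z≤n; s≤s)
open import Data.Nat.Properties using (+-identityʳ; +-comm; +-assoc; m+[n∸m]≡n; ≤-trans; m≤n+m; +-suc)
open import Data.Nat.Divisibility using (_∣_; divides; ∣m∣n⇒∣m+n)
open import Data.Nat.DivMod using (_%_; [m+kn]%n≡m%n)
open import Data.Product using (Σ; ∃; _×_; _,_; proj₁; proj₂)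
import Data.Product as Product
open import Data.Sum using (_⊎_; inj₁; inj₂)
import Data.Sum as Sum
import Data.Vec.Functional as Vector
open import Data.Vec.Functional.Properties using (lookup-++ˡ; lookup-++ʳ)
open import Function using (_∘_; id)
open import Function.Definitions using (Injective)
open import Level using (0ℓ)
open import Relation.Binary.PropositionalEquality hiding ([_])
open import Relation.Nullary using (¬_; Dec; yes; no)
open import Relation.Nullary.Decidable using (True; toWitness; _×-dec_; _⊎-dec_; ¬?; _→-dec_)
open import Relation.Unary using (Pred; Decidable; ∁; _≐_)

private variable
  a b n m k : ℕ

count : ∀ {A : Set} {P : Pred A 0ℓ} → Decidable P → List A → ℕ
count P? = length ∘ filter P?

module _ {A : Set} {P : Pred A 0ℓ} (P? : Decidable P) where

  count-++ : ∀ xs ys → count P? (xs ++ ys) ≡ count P? xs + count P? ys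
  count-++ xs ys = trans (cong length (filter-++ P? xs ys)) (length-++ (filter P? xs))

  count-none : ∀ {xs} → All (∁ P) xs → count P? xs ≡ 0
  count-none = cong length ∘ filter-none P?

  count-[_] : ∀ {x} → P x → count P? [ x ] ≡ 1
  count-[ px ] = cong length (filter-accept P? px)

  count-concat-tabulate : (g : Fin n → List A) (x : Fin n) →
    (∀ y → y ≢ x → All (∁ P) (g y)) → count P? (concat (tabulate g)) ≡ count P? (g x)
  count-concat-tabulate g zero others = begin
    count P? (g zero ++ concat (tabulate (g ∘ suc)))            ≡⟨ count-++ (g zero) _ ⟩
    count P? (g zero) + count P? (concat (tabulate (g ∘ suc)))  ≡⟨ cong (count P? (g zero) +_) rest ⟩
    count P? (g zero) + 0                                       ≡⟨ +-identityʳ _ ⟩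
    count P? (g zero)                                           ∎
    where
    open ≡-Reasoning
    rest : count P? (concat (tabulate (g ∘ suc))) ≡ 0
    rest = count-none (concat⁺ (tabulate⁺ λ y → others (suc y) λ ()))
  count-concat-tabulate g (suc x) others = begin
    count P? (g zero ++ concat (tabulate (g ∘ suc)))            ≡⟨ count-++ (g zero) _ ⟩
    count P? (g zero) + count P? (concat (tabulate (g ∘ suc)))  ≡⟨ cong₂ _+_ first rest ⟩
    count P? (g (suc x))                                        ∎
    where
    open ≡-Reasoning
    first : count P? (g zero) ≡ 0
    first = count-none (others zero λ ())
    rest : count P? (concat (tabulate (g ∘ suc))) ≡ count P? (g (suc x))
    rest = count-concat-tabulate (g ∘ suc) x λ y y≢x → others (suc y) (y≢x ∘ suc-injective)

count-map : ∀ {A B : Set} {P : Pred A 0ℓ} (P? : Decidable P) (f : B → A) xs →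
  count P? (map f xs) ≡ count (P? ∘ f) xs
count-map P? f [] = refl
count-map P? f (x ∷ xs) with P? (f x)
... | yes _ = cong ℕ.suc (count-map P? f xs)
... | no _ = count-map P? f xs

count-≐ : ∀ {A : Set} {P Q : Pred A 0ℓ} (P? : Decidable P) (Q? : Decidable Q) →
  P ≐ Q → ∀ xs → count P? xs ≡ count Q? xs
count-≐ P? Q? P≐Q = cong length ∘ filter-≐ P? Q? P≐Q

mapStar : (f : Fin n → Fin m) → Injective _≡_ _≡_ f → Star3 n → Star3 m
mapStar f f-inj s = star (f (centre s)) (f (leaf₁ s)) (f (leaf₂ s)) (f (leaf₃ s))
  (c≢1 s ∘ f-inj) (c≢2 s ∘ f-inj) (c≢3 s ∘ f-inj) (1≢2 s ∘ f-inj) (1≢3 s ∘ f-inj) (2≢3 s ∘ f-inj)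

IsLeaf : Star3 n → Fin n → Set
IsLeaf s w = w ≡ leaf₁ s ⊎ w ≡ leaf₂ s ⊎ w ≡ leaf₃ s

hasEdge-sym : ∀ (s : Star3 n) {u v} → HasEdge s u v → HasEdge s v u
hasEdge-sym s = Sum.map flip (Sum.map flip flip)
  where
  flip : ∀ {c x u v : Fin _} → edgeIs c x u v → edgeIs c x v u
  flip = Sum.swap ∘ Sum.map Product.swap Product.swap

hasEdge-cases : ∀ (s : Star3 n) {u v} → HasEdge s u v →
  (u ≡ centre s × IsLeaf s v) ⊎ (v ≡ centre s × IsLeaf s u)
hasEdge-cases s (inj₁ (inj₁ (u≡c , v≡l))) = inj₁ (u≡c , inj₁ v≡l)
hasEdge-cases s (inj₁ (inj₂ (u≡l , v≡c))) = inj₂ (v≡c , inj₁ u≡l)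
hasEdge-cases s (inj₂ (inj₁ (inj₁ (u≡c , v≡l)))) = inj₁ (u≡c , inj₂ (inj₁ v≡l))
hasEdge-cases s (inj₂ (inj₁ (inj₂ (u≡l , v≡c)))) = inj₂ (v≡c , inj₂ (inj₁ u≡l))
hasEdge-cases s (inj₂ (inj₂ (inj₁ (u≡c , v≡l)))) = inj₁ (u≡c , inj₂ (inj₂ v≡l))
hasEdge-cases s (inj₂ (inj₂ (inj₂ (u≡l , v≡c)))) = inj₂ (v≡c , inj₂ (inj₂ u≡l))

hasEdge-leaf : ∀ (s : Star3 n) {w} → IsLeaf s w → HasEdge s (centre s) w
hasEdge-leaf s (inj₁ w≡l) = inj₁ (inj₁ (refl , w≡l))
hasEdge-leaf s (inj₂ (inj₁ w≡l)) = inj₂ (inj₁ (inj₁ (refl , w≡l)))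
hasEdge-leaf s (inj₂ (inj₂ w≡l)) = inj₂ (inj₂ (inj₁ (refl , w≡l)))

hasEdge-centred : ∀ (s : Star3 n) {u v} → v ≢ centre s → HasEdge s u v → u ≡ centre s × IsLeaf s v
hasEdge-centred s v≢c = Sum.[ id , ⊥-elim ∘ v≢c ∘ proj₁ ] ∘ hasEdge-cases s

¬hasEdge-nonleaves : ∀ (s : Star3 n) {u v} → ¬ IsLeaf s u → ¬ IsLeaf s v → ¬ HasEdge s u v
¬hasEdge-nonleaves s u∉s v∉s = Sum.[ v∉s ∘ proj₂ , u∉s ∘ proj₂ ] ∘ hasEdge-cases s

¬hasEdge-noncentres : ∀ (s : Star3 n) {u v} → u ≢ centre s → v ≢ centre s → ¬ HasEdge s u v
¬hasEdge-noncentres s u≢c v≢c = Sum.[ u≢c ∘ proj₁ , v≢c ∘ proj₁ ] ∘ hasEdge-cases s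

module _ (f : Fin n → Fin m) (f-inj : Injective _≡_ _≡_ f) where

  mapStar-hasEdge : ∀ s {x y} → HasEdge s x y → HasEdge (mapStar f f-inj s) (f x) (f y)
  mapStar-hasEdge s = Sum.map edge (Sum.map edge edge)
    where
    edge : ∀ {c l x y} → edgeIs c l x y → edgeIs (f c) (f l) (f x) (f y)
    edge = Sum.map (Product.map (cong f) (cong f)) (Product.map (cong f) (cong f))

  mapStar-hasEdge⁻ : ∀ s {x y} → HasEdge (mapStar f f-inj s) (f x) (f y) → HasEdge s x y
  mapStar-hasEdge⁻ s = Sum.map edge (Sum.map edge edge)
    where
    edge : ∀ {c l x y} → edgeIs (f c) (f l) (f x) (f y) → edgeIs c l x y
    edge = Sum.map (Product.map f-inj f-inj) (Product.map f-inj f-inj)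

  mapStar-hasEdge-image : ∀ s {u v} → HasEdge (mapStar f f-inj s) u v → ∃ λ x → u ≡ f x
  mapStar-hasEdge-image s e with hasEdge-cases (mapStar f f-inj s) e
  ... | inj₁ (u≡c , _) = _ , u≡c
  ... | inj₂ (_ , inj₁ u≡l) = _ , u≡l
  ... | inj₂ (_ , inj₂ (inj₁ u≡l)) = _ , u≡l
  ... | inj₂ (_ , inj₂ (inj₂ u≡l)) = _ , u≡l

edgeCount-++ : ∀ (B B′ : List (Star3 n)) u v →
  edgeCount (B ++ B′) u v ≡ edgeCount B u v + edgeCount B′ u v
edgeCount-++ B B′ u v = count-++ (λ s → hasEdge? s u v) B B′

edgeCount-none : ∀ {B : List (Star3 n)} {u v} → All (λ s → ¬ HasEdge s u v) B → edgeCount B u v ≡ 0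
edgeCount-none {u = u} {v} = count-none (λ s → hasEdge? s u v)

edgeCount-sym : ∀ (B : List (Star3 n)) u v → edgeCount B u v ≡ edgeCount B v u
edgeCount-sym B u v =
  count-≐ (λ s → hasEdge? s u v) (λ s → hasEdge? s v u) ((λ {s} → hasEdge-sym s) , λ {s} → hasEdge-sym s) B

module _ (f : Fin n → Fin m) (f-inj : Injective _≡_ _≡_ f) (B : List (Star3 n)) where

  edgeCount-map : ∀ x y → edgeCount (map (mapStar f f-inj) B) (f x) (f y) ≡ edgeCount B x y
  edgeCount-map x y = trans (count-map (λ s → hasEdge? s (f x) (f y)) (mapStar f f-inj) B)
    (count-≐ _ (λ s → hasEdge? s x y) ((λ {s} → mapStar-hasEdge⁻ f f-inj s) , λ {s} → mapStar-hasEdge f f-inj s) B)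

  edgeCount-map-∉ˡ : ∀ {u} v → (∀ x → u ≢ f x) → edgeCount (map (mapStar f f-inj) B) u v ≡ 0
  edgeCount-map-∉ˡ v u∉f = edgeCount-none (map⁺ (All.universal
    (λ s e → let x , u≡fx = mapStar-hasEdge-image f f-inj s e in u∉f x u≡fx) B))

  edgeCount-map-∉ʳ : ∀ u {v} → (∀ x → v ≢ f x) → edgeCount (map (mapStar f f-inj) B) u v ≡ 0
  edgeCount-map-∉ʳ u {v} v∉f = trans (edgeCount-sym (map (mapStar f f-inj) B) u v) (edgeCount-map-∉ˡ u v∉f)

record Triple (n : ℕ) : Set where
  constructor triple
  field
    v₁ v₂ v₃ : Fin n
    v₁≢v₂ : v₁ ≢ v₂
    v₁≢v₃ : v₁ ≢ v₃
    v₂≢v₃ : v₂ ≢ v₃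

open Triple

_∈ₜ_ : Fin n → Triple n → Set
w ∈ₜ t = w ≡ v₁ t ⊎ w ≡ v₂ t ⊎ w ≡ v₃ t

_∈ₜ?_ : (w : Fin n) (t : Triple n) → Dec (w ∈ₜ t)
w ∈ₜ? t = (w ≟ v₁ t) ⊎-dec (w ≟ v₂ t) ⊎-dec (w ≟ v₃ t)

MonochromaticTriple : (Fin n → Fin k) → Triple n → Set
MonochromaticTriple col t = col (v₂ t) ≡ col (v₁ t) × col (v₃ t) ≡ col (v₁ t)

tripleCount : List (Triple n) → Fin n → ℕ
tripleCount T w = count (w ∈ₜ?_) T

IsTriplePartition : List (Triple n) → Set
IsTriplePartition T = ∀ w → tripleCount T w ≡ 1

mapTriple : (f : Fin n → Fin m) → Injective _≡_ _≡_ f → Triple n → Triple m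
mapTriple f f-inj t =
  triple (f (v₁ t)) (f (v₂ t)) (f (v₃ t)) (v₁≢v₂ t ∘ f-inj) (v₁≢v₃ t ∘ f-inj) (v₂≢v₃ t ∘ f-inj)

module _ (f : Fin n → Fin m) (f-inj : Injective _≡_ _≡_ f) where

  ∈ₜ-map⁺ : ∀ {w t} → w ∈ₜ t → f w ∈ₜ mapTriple f f-inj t
  ∈ₜ-map⁺ = Sum.map (cong f) (Sum.map (cong f) (cong f))

  ∈ₜ-map⁻ : ∀ {w t} → f w ∈ₜ mapTriple f f-inj t → w ∈ₜ t
  ∈ₜ-map⁻ = Sum.map f-inj (Sum.map f-inj f-inj)

  ∈ₜ-map-image : ∀ {u t} → u ∈ₜ mapTriple f f-inj t → ∃ λ w → u ≡ f w
  ∈ₜ-map-image = Sum.[ _ ,_ , Sum.[ _ ,_ , _ ,_ ] ]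

  tripleCount-map : ∀ T w → tripleCount (map (mapTriple f f-inj) T) (f w) ≡ tripleCount T w
  tripleCount-map T w = trans (count-map (f w ∈ₜ?_) (mapTriple f f-inj) T)
    (count-≐ _ (w ∈ₜ?_) ((λ {t} → ∈ₜ-map⁻ {w} {t}) , λ {t} → ∈ₜ-map⁺ {w} {t}) T)

  tripleCount-map-∉ : ∀ T {u} → (∀ w → u ≢ f w) → tripleCount (map (mapTriple f f-inj) T) u ≡ 0
  tripleCount-map-∉ T {u} u∉f = count-none (u ∈ₜ?_)
    (map⁺ (All.universal (λ t u∈t → let w , u≡fw = ∈ₜ-map-image {t = t} u∈t in u∉f w u≡fw) T))

cone : (c : Fin n) (t : Triple n) → ¬ c ∈ₜ t → Star3 n
cone c t c∉t = star c (v₁ t) (v₂ t) (v₃ t)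
  (c∉t ∘ inj₁) (c∉t ∘ inj₂ ∘ inj₁) (c∉t ∘ inj₂ ∘ inj₂) (v₁≢v₂ t) (v₁≢v₃ t) (v₂≢v₃ t)

-- Gluing along a decomposition of the complete bipartite graph

↑ˡ≢↑ʳ : (x : Fin a) (y : Fin b) → x ↑ˡ b ≢ a ↑ʳ y
↑ˡ≢↑ʳ {a} {b} x y eq with trans (sym (splitAt-↑ˡ a x b)) (trans (cong (splitAt a) eq) (splitAt-↑ʳ a b y))
... | ()

data Split (a b : ℕ) : Fin (a + b) → Set where
  left : (x : Fin a) → Split a b (x ↑ˡ b)
  right : (y : Fin b) → Split a b (a ↑ʳ y)

split : ∀ a {b} (w : Fin (a + b)) → Split a b w
split ℕ.zero w = right w
split (ℕ.suc a) zero = left zero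
split (ℕ.suc a) (suc w) with split a w
... | left x = left (suc x)
... | right y = right y

embedˡ : ∀ b → Star3 a → Star3 (a + b)
embedˡ b = mapStar (_↑ˡ b) (↑ˡ-injective b _ _)

embedʳ : ∀ a → Star3 b → Star3 (a + b)
embedʳ a = mapStar (a ↑ʳ_) (↑ʳ-injective a _ _)

embedTripleˡ : ∀ b → Triple a → Triple (a + b)
embedTripleˡ b = mapTriple (_↑ˡ b) (↑ˡ-injective b _ _)

embedTripleʳ : ∀ a → Triple b → Triple (a + b)
embedTripleʳ a = mapTriple (a ↑ʳ_) (↑ʳ-injective a _ _)

Crossing : ∀ a b → Star3 (a + b) → Set
Crossing a b s = (∀ x x′ → ¬ HasEdge s (x ↑ˡ b) (x′ ↑ˡ b)) × (∀ y y′ → ¬ HasEdge s (a ↑ʳ y) (a ↑ʳ y′))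

record IsBicliqueDecomposition (a b : ℕ) (X : List (Star3 (a + b))) : Set where
  field
    crossing : All (Crossing a b) X
    covers : ∀ x y → edgeCount X (x ↑ˡ b) (a ↑ʳ y) ≡ 1

glue-isStarSystem : ∀ {A B X} → IsStarSystem a A → IsStarSystem b B → IsBicliqueDecomposition a b X →
  IsStarSystem (a + b) (map (embedˡ b) A ++ map (embedʳ a) B ++ X)
glue-isStarSystem {a} {b} {A} {B} {X} A-sys B-sys X-dec = count-one
  where
  open IsBicliqueDecomposition X-dec
  L : Fin a → Fin (a + b)
  L = _↑ˡ b
  R : Fin b → Fin (a + b)
  R = a ↑ʳ_
  countL : ∀ x x′ → edgeCount (map (embedˡ b) A) (L x) (L x′) ≡ edgeCount A x x′
  countL = edgeCount-map L (↑ˡ-injective b _ _) A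
  countR : ∀ y y′ → edgeCount (map (embedʳ a) B) (R y) (R y′) ≡ edgeCount B y y′
  countR = edgeCount-map R (↑ʳ-injective a _ _) B
  countL-∉ : ∀ {u} v → (∀ x → u ≢ L x) → edgeCount (map (embedˡ b) A) u v ≡ 0
  countL-∉ = edgeCount-map-∉ˡ L (↑ˡ-injective b _ _) A
  countR-∉ : ∀ {u} v → (∀ y → u ≢ R y) → edgeCount (map (embedʳ a) B) u v ≡ 0
  countR-∉ = edgeCount-map-∉ˡ R (↑ʳ-injective a _ _) B

  split-count : ∀ u v → edgeCount (map (embedˡ b) A ++ map (embedʳ a) B ++ X) u v ≡
    edgeCount (map (embedˡ b) A) u v + (edgeCount (map (embedʳ a) B) u v + edgeCount X u v)
  split-count u v = trans (edgeCount-++ (map (embedˡ b) A) _ u v)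
    (cong (edgeCount (map (embedˡ b) A) u v +_) (edgeCount-++ (map (embedʳ a) B) X u v))

  count-LR : ∀ x y → edgeCount (map (embedˡ b) A ++ map (embedʳ a) B ++ X) (L x) (R y) ≡ 1
  count-LR x y = trans (split-count _ _) (cong₂ _+_
    (edgeCount-map-∉ʳ L (↑ˡ-injective b _ _) A (L x) λ x′ → ↑ˡ≢↑ʳ x′ y ∘ sym)
    (cong₂ _+_ (countR-∉ (R y) (↑ˡ≢↑ʳ x)) (covers x y)))

  count-one : IsStarSystem (a + b) (map (embedˡ b) A ++ map (embedʳ a) B ++ X)
  count-one u v u≢v with split a u | split a v
  ... | left x | left x′ = trans (split-count _ _) (cong₂ _+_
    (trans (countL x x′) (A-sys x x′ (u≢v ∘ cong L)))
    (cong₂ _+_ (countR-∉ (L x′) (↑ˡ≢↑ʳ x)) (edgeCount-none (All.map (λ c → proj₁ c x x′) crossing))))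
  ... | right y | right y′ = trans (split-count _ _) (cong₂ _+_
    (countL-∉ (R y′) (λ x → ↑ˡ≢↑ʳ x y ∘ sym))
    (cong₂ _+_ (trans (countR y y′) (B-sys y y′ (u≢v ∘ cong R)))
               (edgeCount-none (All.map (λ c → proj₂ c y y′) crossing))))
  ... | left x | right y = count-LR x y
  ... | right y | left x =
    trans (edgeCount-sym (map (embedˡ b) A ++ map (embedʳ a) B ++ X) (R y) (L x)) (count-LR x y)

Proper : (Fin n → Fin k) → List (Star3 n) → Set
Proper col B = All (λ s → ¬ Monochromatic col s) B

ProperTriples : (Fin n → Fin k) → List (Triple n) → Set
ProperTriples col T = All (λ t → ¬ MonochromaticTriple col t) T

leaves : Star3 n → Triple n
leaves s = triple (leaf₁ s) (leaf₂ s) (leaf₃ s) (1≢2 s) (1≢3 s) (2≢3 s)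

monochromatic-leaves : ∀ {col : Fin n → Fin k} s → Monochromatic col s → MonochromaticTriple col (leaves s)
monochromatic-leaves s (e₁ , e₂ , e₃) = trans e₂ (sym e₁) , trans e₃ (sym e₁)

module _ {col col′ : Fin n → Fin k} (col≗col′ : ∀ w → col w ≡ col′ w) where

  private
    recolour-≡ : ∀ {u v} → col u ≡ col v → col′ u ≡ col′ v
    recolour-≡ {u} {v} eq = trans (sym (col≗col′ u)) (trans eq (col≗col′ v))

  monochromatic-cong : ∀ s → Monochromatic col s → Monochromatic col′ s
  monochromatic-cong s = Product.map recolour-≡ (Product.map recolour-≡ recolour-≡)

  monochromaticTriple-cong : ∀ t → MonochromaticTriple col t → MonochromaticTriple col′ t
  monochromaticTriple-cong t = Product.map recolour-≡ recolour-≡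

module _ {col : Fin n → Fin k} (g : Fin k → Fin m) (g-inj : Injective _≡_ _≡_ g) where

  monochromatic-injective : ∀ s → Monochromatic (g ∘ col) s → Monochromatic col s
  monochromatic-injective s = Product.map g-inj (Product.map g-inj g-inj)

  monochromaticTriple-injective : ∀ t → MonochromaticTriple (g ∘ col) t → MonochromaticTriple col t
  monochromaticTriple-injective t = Product.map g-inj g-inj

module _ {col : Fin m → Fin k} {col′ : Fin n → Fin k} (f : Fin n → Fin m) (f-inj : Injective _≡_ _≡_ f)
         (col∘f≗col′ : ∀ w → col (f w) ≡ col′ w) where

  map-proper : ∀ {B} → Proper col′ B → Proper col (map (mapStar f f-inj) B)
  map-proper = map⁺ ∘ All.map (λ {s} ¬mono → ¬mono ∘ monochromatic-cong col∘f≗col′ s)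

  map-properTriples : ∀ {T} → ProperTriples col′ T → ProperTriples col (map (mapTriple f f-inj) T)
  map-properTriples = map⁺ ∘ All.map (λ {t} ¬mono → ¬mono ∘ monochromaticTriple-cong col∘f≗col′ t)

colourable-punchOut : ∀ {B : List (Star3 n)} {col : Fin n → Fin (ℕ.suc k)} {γ} →
  Proper col B → (∀ w → γ ≢ col w) → Colourable B k
colourable-punchOut {col = col} col-proper avoids =
  (λ w → punchOut (avoids w)) , All.map (λ ¬mono → ¬mono ∘ Product.map unpunch (Product.map unpunch unpunch)) col-proper
  where
  unpunch : ∀ {u v} → punchOut (avoids u) ≡ punchOut (avoids v) → col u ≡ col v
  unpunch = punchOut-injective (avoids _) (avoids _)

record ColouredSystem (n k : ℕ) : Set where
  field
    stars : List (Star3 n)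
    isStarSystem : IsStarSystem n stars
    colouring : Fin n → Fin k
    proper : Proper colouring stars

open ColouredSystem

record PartitionedSystem (n k : ℕ) : Set where
  field
    system : ColouredSystem n k
    triples : List (Triple n)
    isTriplePartition : IsTriplePartition triples
    triples-proper : ProperTriples (colouring system) triples
    3∣n : 3 ∣ n

open PartitionedSystem

recolour : (g : Fin k → Fin m) → Injective _≡_ _≡_ g → ColouredSystem n k → ColouredSystem n m
recolour g g-inj S = record
  { stars = stars S
  ; isStarSystem = isStarSystem S
  ; colouring = g ∘ colouring S
  ; proper = All.map (λ {s} ¬mono → ¬mono ∘ monochromatic-injective {col = colouring S} g g-inj s) (proper S)
  }

recolourᵖ : (g : Fin k → Fin m) → Injective _≡_ _≡_ g → PartitionedSystem n k → PartitionedSystem n m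
recolourᵖ g g-inj P = record
  { system = recolour g g-inj (system P)
  ; triples = triples P
  ; isTriplePartition = isTriplePartition P
  ; 3∣n = 3∣n P
  ; triples-proper = All.map
      (λ {t} ¬mono → ¬mono ∘ monochromaticTriple-injective {col = colouring (system P)} g g-inj t) (triples-proper P)
  }

glue : (A : ColouredSystem a k) (B : ColouredSystem b k) (X : List (Star3 (a + b))) →
  IsBicliqueDecomposition a b X → Proper (colouring A Vector.++ colouring B) X → ColouredSystem (a + b) k
glue {a} {b = b} A B X X-dec X-proper = record
  { stars = map (embedˡ b) (stars A) ++ map (embedʳ a) (stars B) ++ X
  ; isStarSystem = glue-isStarSystem {A = stars A} {stars B} (isStarSystem A) (isStarSystem B) X-dec
  ; colouring = colouring A Vector.++ colouring B
  ; proper = ++⁺ (map-proper (_↑ˡ b) (↑ˡ-injective b _ _) (lookup-++ˡ (colouring A) (colouring B)) (proper A))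
                 (++⁺ (map-proper (a ↑ʳ_) (↑ʳ-injective a _ _) (lookup-++ʳ (colouring A) (colouring B)) (proper B))
                      X-proper)
  }

glue-isTriplePartition : ∀ {TA : List (Triple a)} {TB : List (Triple b)} →
  IsTriplePartition TA → IsTriplePartition TB →
  IsTriplePartition (map (embedTripleˡ b) TA ++ map (embedTripleʳ a) TB)
glue-isTriplePartition {a} {b} {TA} {TB} TA-part TB-part w with split a w
... | left x = trans (count-++ (w ∈ₜ?_) (map (embedTripleˡ b) TA) _) (cong₂ _+_
  (trans (tripleCount-map (_↑ˡ b) (↑ˡ-injective b _ _) TA x) (TA-part x))
  (tripleCount-map-∉ (a ↑ʳ_) (↑ʳ-injective a _ _) TB (↑ˡ≢↑ʳ x)))
... | right y = trans (count-++ (w ∈ₜ?_) (map (embedTripleˡ b) TA) _) (cong₂ _+_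
  (tripleCount-map-∉ (_↑ˡ b) (↑ˡ-injective b _ _) TA (λ x → ↑ˡ≢↑ʳ x y ∘ sym))
  (trans (tripleCount-map (a ↑ʳ_) (↑ʳ-injective a _ _) TB y) (TB-part y)))

glueᵖ : (A : PartitionedSystem a k) (B : PartitionedSystem b k) (X : List (Star3 (a + b))) →
  IsBicliqueDecomposition a b X → Proper (colouring (system A) Vector.++ colouring (system B)) X →
  PartitionedSystem (a + b) k
glueᵖ {a} {k} {b} A B X X-dec X-proper = record
  { system = glue (system A) (system B) X X-dec X-proper
  ; triples = map (embedTripleˡ b) (triples A) ++ map (embedTripleʳ a) (triples B)
  ; isTriplePartition = glue-isTriplePartition {TA = triples A} {triples B} (isTriplePartition A) (isTriplePartition B)
  ; triples-proper = ++⁺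
      (map-properTriples (_↑ˡ b) (↑ˡ-injective b _ _) (lookup-++ˡ cA cB) (triples-proper A))
      (map-properTriples (a ↑ʳ_) (↑ʳ-injective a _ _) (lookup-++ʳ cA cB) (triples-proper B))
  ; 3∣n = ∣m∣n⇒∣m+n (3∣n A) (3∣n B)
  }
  where
  cA : Fin a → Fin k
  cA = colouring (system A)
  cB : Fin b → Fin k
  cB = colouring (system B)

-- Joining and attaching

↑ˡ∉embedTripleʳ : ∀ (x : Fin a) (t : Triple b) → ¬ (x ↑ˡ b) ∈ₜ embedTripleʳ a t
↑ˡ∉embedTripleʳ {a} x t x∈t =
  let y , eq = ∈ₜ-map-image (a ↑ʳ_) (↑ʳ-injective a _ _) {t = t} x∈t in ↑ˡ≢↑ʳ x y eq

↑ʳ∉embedTripleˡ : ∀ (y : Fin b) (t : Triple a) → ¬ (a ↑ʳ y) ∈ₜ embedTripleˡ b t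
↑ʳ∉embedTripleˡ {b} y t y∈t =
  let x , eq = ∈ₜ-map-image (_↑ˡ b) (↑ˡ-injective b _ _) {t = t} y∈t in ↑ˡ≢↑ʳ x y (sym eq)

crossStar : Fin a → Triple b → Star3 (a + b)
crossStar {a} {b} x t = cone (x ↑ˡ b) (embedTripleʳ a t) (↑ˡ∉embedTripleʳ x t)

backStar : ∀ {a} → Fin b → Triple a → Star3 (a + b)
backStar {b} {a} y t = cone (a ↑ʳ y) (embedTripleˡ b t) (↑ʳ∉embedTripleˡ y t)

module _ {a b : ℕ} where

  crossStar-crossing : ∀ x t → Crossing a b (crossStar x t)
  crossStar-crossing x t =
    (λ x₁ x₂ → ¬hasEdge-nonleaves (crossStar x t) (↑ˡ∉embedTripleʳ x₁ t) (↑ˡ∉embedTripleʳ x₂ t)) ,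
    (λ y₁ y₂ → ¬hasEdge-noncentres (crossStar x t) (↑ˡ≢↑ʳ x y₁ ∘ sym) (↑ˡ≢↑ʳ x y₂ ∘ sym))

  backStar-crossing : ∀ y t → Crossing a b (backStar y t)
  backStar-crossing y t =
    (λ x₁ x₂ → ¬hasEdge-noncentres (backStar y t) (↑ˡ≢↑ʳ x₁ y) (↑ˡ≢↑ʳ x₂ y)) ,
    (λ y₁ y₂ → ¬hasEdge-nonleaves (backStar y t) (↑ʳ∉embedTripleˡ y₁ t) (↑ʳ∉embedTripleˡ y₂ t))

  crossStar-hasEdge : ∀ x t {y} → y ∈ₜ t → HasEdge (crossStar x t) (x ↑ˡ b) (a ↑ʳ y)
  crossStar-hasEdge x t y∈t = hasEdge-leaf (crossStar x t) (∈ₜ-map⁺ (a ↑ʳ_) (↑ʳ-injective a _ _) {t = t} y∈t)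

  crossStar-hasEdge⁻ : ∀ x′ t {x y} → HasEdge (crossStar x′ t) (x ↑ˡ b) (a ↑ʳ y) → x ≡ x′ × y ∈ₜ t
  crossStar-hasEdge⁻ x′ t {x} {y} e =
    let x≡x′ , y∈t = hasEdge-centred (crossStar x′ t) (↑ˡ≢↑ʳ x′ y ∘ sym) e
    in ↑ˡ-injective b _ _ x≡x′ , ∈ₜ-map⁻ (a ↑ʳ_) (↑ʳ-injective a _ _) {t = t} y∈t

  backStar-hasEdge : ∀ y t {x} → x ∈ₜ t → HasEdge (backStar y t) (x ↑ˡ b) (a ↑ʳ y)
  backStar-hasEdge y t x∈t =
    hasEdge-sym (backStar y t) (hasEdge-leaf (backStar y t) (∈ₜ-map⁺ (_↑ˡ b) (↑ˡ-injective b _ _) {t = t} x∈t))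

  backStar-hasEdge⁻ : ∀ y′ t {x y} → HasEdge (backStar y′ t) (x ↑ˡ b) (a ↑ʳ y) → y ≡ y′ × x ∈ₜ t
  backStar-hasEdge⁻ y′ t {x} {y} e =
    let y≡y′ , x∈t = hasEdge-centred (backStar y′ t) (↑ˡ≢↑ʳ x y′) (hasEdge-sym (backStar y′ t) e)
    in ↑ʳ-injective a _ _ y≡y′ , ∈ₜ-map⁻ (_↑ˡ b) (↑ˡ-injective b _ _) {t = t} x∈t

  crossStar-proper : ∀ {c₁ : Fin a → Fin k} {c₂ : Fin b → Fin k} x t →
    ¬ MonochromaticTriple c₂ t → ¬ Monochromatic (c₁ Vector.++ c₂) (crossStar x t)
  crossStar-proper {c₁ = c₁} {c₂} x t ¬mono =
    λ mono → ¬mono (monochromaticTriple-cong (lookup-++ʳ c₁ c₂) t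
                     (monochromatic-leaves {col = c₁ Vector.++ c₂} (crossStar x t) mono))

  backStar-proper : ∀ {c₁ : Fin a → Fin k} {c₂ : Fin b → Fin k} y t →
    c₂ y ≢ c₁ (v₁ t) → ¬ Monochromatic (c₁ Vector.++ c₂) (backStar y t)
  backStar-proper {c₁ = c₁} {c₂} y t c₂y≢c₁v₁ (e₁ , _) =
    c₂y≢c₁v₁ (sym (trans (sym (lookup-++ˡ c₁ c₂ (v₁ t))) (trans e₁ (lookup-++ʳ c₁ c₂ y))))

  crossFan : (Fin a → List (Triple b)) → List (Star3 (a + b))
  crossFan g = concat (tabulate λ x → map (crossStar x) (g x))

  crossFan-crossing : ∀ g → All (Crossing a b) (crossFan g)
  crossFan-crossing g = concat⁺ (tabulate⁺ λ x → map⁺ (All.universal (crossStar-crossing x) (g x)))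

  crossFan-count : ∀ g x y → edgeCount (crossFan g) (x ↑ˡ b) (a ↑ʳ y) ≡ tripleCount (g x) y
  crossFan-count g x y = begin
    edgeCount (crossFan g) (x ↑ˡ b) (a ↑ʳ y)            ≡⟨ count-concat-tabulate edge? _ x others ⟩
    count edge? (map (crossStar x) (g x))               ≡⟨ count-map edge? (crossStar x) (g x) ⟩
    count (edge? ∘ crossStar x) (g x)                   ≡⟨ count-≐ _ (y ∈ₜ?_) same-edges (g x) ⟩
    tripleCount (g x) y                                 ∎
    where
    open ≡-Reasoning
    edge? : Decidable (λ s → HasEdge s (x ↑ˡ b) (a ↑ʳ y))
    edge? s = hasEdge? s (x ↑ˡ b) (a ↑ʳ y)
    same-edges : (λ t → HasEdge (crossStar x t) (x ↑ˡ b) (a ↑ʳ y)) ≐ (y ∈ₜ_)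
    same-edges = (λ {t} → proj₂ ∘ crossStar-hasEdge⁻ x t) , λ {t} → crossStar-hasEdge x t
    others : ∀ x′ → x′ ≢ x → All (λ s → ¬ HasEdge s (x ↑ˡ b) (a ↑ʳ y)) (map (crossStar x′) (g x′))
    others x′ x′≢x = map⁺ (All.universal (λ t → x′≢x ∘ sym ∘ proj₁ ∘ crossStar-hasEdge⁻ x′ t) (g x′))

  crossFan-proper : ∀ {c₁ : Fin a → Fin k} {c₂ : Fin b → Fin k} {g} →
    (∀ x → ProperTriples c₂ (g x)) → Proper (c₁ Vector.++ c₂) (crossFan g)
  crossFan-proper {c₁ = c₁} g-proper =
    concat⁺ (tabulate⁺ λ x → map⁺ (All.map (λ {t} → crossStar-proper {c₁ = c₁} x t) (g-proper x)))

  backFan : Triple a → List (Star3 (a + b))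
  backFan t = concat (tabulate λ y → [ backStar y t ])

  backFan-crossing : ∀ t → All (Crossing a b) (backFan t)
  backFan-crossing t = concat⁺ (tabulate⁺ λ y → backStar-crossing y t ∷ [])

  backFan-count-∈ : ∀ {t x} y → x ∈ₜ t → edgeCount (backFan t) (x ↑ˡ b) (a ↑ʳ y) ≡ 1
  backFan-count-∈ {t} {x} y x∈t = trans
    (count-concat-tabulate edge? _ y λ y′ y′≢y → (y′≢y ∘ sym ∘ proj₁ ∘ backStar-hasEdge⁻ y′ t) ∷ [])
    (count-[ edge? ] (backStar-hasEdge y t x∈t))
    where
    edge? : Decidable (λ s → HasEdge s (x ↑ˡ b) (a ↑ʳ y))
    edge? s = hasEdge? s (x ↑ˡ b) (a ↑ʳ y)

  backFan-count-∉ : ∀ {t x} y → ¬ x ∈ₜ t → edgeCount (backFan t) (x ↑ˡ b) (a ↑ʳ y) ≡ 0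
  backFan-count-∉ {t} y x∉t =
    edgeCount-none (concat⁺ (tabulate⁺ λ y′ → (x∉t ∘ proj₂ ∘ backStar-hasEdge⁻ y′ t) ∷ []))

  backFan-proper : ∀ {c₁ : Fin a → Fin k} {c₂ : Fin b → Fin k} {t} →
    (∀ y → c₂ y ≢ c₁ (v₁ t)) → Proper (c₁ Vector.++ c₂) (backFan t)
  backFan-proper {c₁ = c₁} {t = t} avoids =
    concat⁺ (tabulate⁺ λ y → backStar-proper {c₁ = c₁} y t (avoids y) ∷ [])

crossFan-decomposition : ∀ {T : List (Triple b)} → IsTriplePartition T →
  IsBicliqueDecomposition a b (crossFan (λ _ → T))
crossFan-decomposition {T = T} T-part = record
  { crossing = crossFan-crossing _
  ; covers = λ x y → trans (crossFan-count (λ _ → T) x y) (T-part y)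
  }

_⊕_ : ColouredSystem a k → PartitionedSystem b k → ColouredSystem (a + b) k
A ⊕ P = glue A (system P) (crossFan (λ _ → triples P))
  (crossFan-decomposition (isTriplePartition P)) (crossFan-proper (λ _ → triples-proper P))

_⊕ᵖ_ : PartitionedSystem a k → PartitionedSystem b k → PartitionedSystem (a + b) k
A ⊕ᵖ P = glueᵖ A P (crossFan (λ _ → triples P))
  (crossFan-decomposition (isTriplePartition P)) (crossFan-proper (λ _ → triples-proper P))

¬colourable-⊕ : ∀ (A : ColouredSystem a k) (P : PartitionedSystem b k) {m} →
  ¬ Colourable (stars (system P)) m → ¬ Colourable (stars (A ⊕ P)) m
¬colourable-⊕ {a} A P ¬colourable (col , col-proper) =
  ¬colourable (col ∘ (a ↑ʳ_) , map⁻ (++⁻ˡ _ (++⁻ʳ (map (embedˡ _) (stars A)) col-proper)))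

avoiding : Triple a → List (Triple b) → Fin a → List (Triple b)
avoiding t T x with x ∈ₜ? t
... | yes _ = []
... | no _ = T

attachFan : Triple a → List (Triple b) → List (Star3 (a + b))
attachFan t T = backFan t ++ crossFan (avoiding t T)

attachFan-decomposition : ∀ (t : Triple a) {T : List (Triple b)} → IsTriplePartition T →
  IsBicliqueDecomposition a b (attachFan t T)
attachFan-decomposition {a} {b} t {T} T-part = record
  { crossing = ++⁺ (backFan-crossing t) (crossFan-crossing _)
  ; covers = λ x y → trans (edgeCount-++ (backFan t) (crossFan (avoiding t T)) (x ↑ˡ b) (a ↑ʳ y))
                       (trans (cong (edgeCount (backFan t) (x ↑ˡ b) (a ↑ʳ y) +_) (crossFan-count (avoiding t T) x y))
                              (covers x y))
  }
  where
  covers : ∀ x y → edgeCount (backFan t) (x ↑ˡ b) (a ↑ʳ y) + tripleCount (avoiding t T x) y ≡ 1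
  covers x y with x ∈ₜ? t
  ... | yes x∈t = cong (_+ 0) (backFan-count-∈ {t = t} y x∈t)
  ... | no x∉t = cong₂ _+_ (backFan-count-∉ {t = t} y x∉t) (T-part y)

avoiding-proper : ∀ {col : Fin b → Fin k} (t : Triple a) {T} → ProperTriples col T →
  ∀ x → ProperTriples col (avoiding t T x)
avoiding-proper t T-proper x with x ∈ₜ? t
... | yes _ = []
... | no _ = T-proper

attach : PartitionedSystem a (ℕ.suc k) → Triple a → PartitionedSystem b k → PartitionedSystem (a + b) (ℕ.suc k)
attach {k = k} {b = b} W t C = glueᵖ W C′ (attachFan t (triples C)) (attachFan-decomposition t (isTriplePartition C))
  (++⁺ (backFan-proper {c₁ = colouring (system W)} {t = t} (λ y → punchInᵢ≢i γ (colouring (system C) y)))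
       (crossFan-proper {c₁ = colouring (system W)} (avoiding-proper t (triples-proper C′))))
  where
  γ : Fin (ℕ.suc k)
  γ = colouring (system W) (v₁ t)
  C′ : PartitionedSystem b (ℕ.suc k)
  C′ = recolourᵖ (punchIn γ) (punchIn-injective γ _ _) C

attach-forces : ∀ (W : PartitionedSystem a (ℕ.suc (ℕ.suc k))) t (C : PartitionedSystem b (ℕ.suc k)) →
  ¬ Colourable (stars (system C)) k →
  ∀ (col : Fin (a + b) → Fin (ℕ.suc k)) → Proper col (stars (system (attach W t C))) →
  Proper (col ∘ (_↑ˡ b)) (stars (system W)) × ¬ MonochromaticTriple (col ∘ (_↑ˡ b)) t
attach-forces {a} {b = b} W t C ¬colourable col col-proper = map⁻ W-proper , t-not-monochromatic
  where
  L : Fin a → Fin (a + b)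
  L = _↑ˡ b
  R : Fin b → Fin (a + b)
  R = a ↑ʳ_
  beyond-W : Proper col (map (embedʳ a) (stars (system C)) ++ attachFan t (triples C))
  beyond-W = ++⁻ʳ (map (embedˡ b) (stars (system W))) col-proper
  W-proper : Proper col (map (embedˡ b) (stars (system W)))
  W-proper = ++⁻ˡ (map (embedˡ b) (stars (system W))) col-proper
  C-proper : Proper (col ∘ R) (stars (system C))
  C-proper = map⁻ (++⁻ˡ (map (embedʳ a) (stars (system C))) beyond-W)
  backFan-proper⁻ : ∀ y → ¬ Monochromatic col (backStar y t)
  backFan-proper⁻ y = All.head (tabulate⁻ (concat⁻ fan-proper) y)
    where
    fan-proper : Proper col (backFan t)
    fan-proper = ++⁻ˡ (backFan t) (++⁻ʳ (map (embedʳ a) (stars (system C))) beyond-W)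
  t-not-monochromatic : ¬ MonochromaticTriple (col ∘ L) t
  t-not-monochromatic (e₂ , e₃) = ¬colourable (colourable-punchOut C-proper avoids)
    where
    avoids : ∀ y → col (L (v₁ t)) ≢ col (R y)
    avoids y e = backFan-proper⁻ y (e , trans e₂ e , trans e₃ e)

module Forcing {N k : ℕ} (C : PartitionedSystem N (ℕ.suc k)) (¬colourable : ¬ Colourable (stars (system C)) k) where

  -- The triples live on a fixed vertex set, mapped into W by e, so that the recursion is structural.
  record Extension (W : PartitionedSystem n (ℕ.suc (ℕ.suc k))) (e : Fin m → Fin n) (ts : List (Triple m)) : Set where
    field
      size : ℕ
      extension : PartitionedSystem size (ℕ.suc (ℕ.suc k))
      embedding : Fin n → Fin size
      forces : ∀ (col : Fin size → Fin (ℕ.suc k)) → Proper col (stars (system extension)) →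
        Proper (col ∘ embedding) (stars (system W)) × ProperTriples (col ∘ embedding ∘ e) ts

  open Extension public

  extend : (W : PartitionedSystem n (ℕ.suc (ℕ.suc k))) (e : Fin m → Fin n) (e-inj : Injective _≡_ _≡_ e)
    (ts : List (Triple m)) → Extension W e ts
  extend W e e-inj [] = record { extension = W ; embedding = id ; forces = λ _ col-proper → col-proper , [] }
  extend {n} W e e-inj (t ∷ ts) = record
    { extension = extension E
    ; embedding = embedding E ∘ (_↑ˡ N)
    ; forces = λ col col-proper →
        let attach-proper , ts-proper = forces E col col-proper
            W-proper , t-proper = attach-forces W t′ C ¬colourable (col ∘ embedding E) attach-proper
        in W-proper , t-proper ∷ ts-proper
    }
    where
    t′ : Triple n
    t′ = mapTriple e e-inj t
    E : Extension (attach W t′ C) ((_↑ˡ N) ∘ e) ts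
    E = extend (attach W t′ C) ((_↑ˡ N) ∘ e) (e-inj ∘ ↑ˡ-injective N _ _) ts

-- Three vertices of one colour

distinct? : (x y z : Fin n) → Dec (x ≢ y × x ≢ z × y ≢ z)
distinct? x y z = ¬? (x ≟ y) ×-dec ¬? (x ≟ z) ×-dec ¬? (y ≟ z)

tripleIfDistinct : (x y z : Fin n) → List (Triple n)
tripleIfDistinct x y z with distinct? x y z
... | yes (x≢y , x≢z , y≢z) = [ triple x y z x≢y x≢z y≢z ]
... | no _ = []

allTriples : ∀ n → List (Triple n)
allTriples n = concat (tabulate λ x → concat (tabulate λ y → concat (tabulate λ z → tripleIfDistinct x y z)))

-- MonochromaticTriple only inspects vertices, so it transfers to the copy of t in allTriples.
allTriples-monochromatic : ∀ {col : Fin n → Fin k} t → MonochromaticTriple col t →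
  Any (MonochromaticTriple col) (allTriples n)
allTriples-monochromatic t mono =
  Any.concat⁺ (Any.tabulate⁺ (v₁ t)
    (Any.concat⁺ (Any.tabulate⁺ (v₂ t) (Any.concat⁺ (Any.tabulate⁺ (v₃ t) found)))))
  where
  found : Any (MonochromaticTriple _) (tripleIfDistinct (v₁ t) (v₂ t) (v₃ t))
  found with distinct? (v₁ t) (v₂ t) (v₃ t)
  ... | yes _ = here mono
  ... | no indistinct = ⊥-elim (indistinct (v₁≢v₂ t , v₁≢v₃ t , v₂≢v₃ t))

-- Tag each vertex with its colour, taken from a second copy of the colours when an
-- earlier vertex already has that colour: two equal tags then yield three vertices of one colour.
module _ {n k : ℕ} (col : Fin n → Fin k) where

  private
    Earlier : Fin n → Set
    Earlier i = ∃ λ h → h < i × col h ≡ col i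

    earlier? : ∀ i → Dec (Earlier i)
    earlier? i = any? λ h → (h <? i) ×-dec (col h ≟ col i)

    tag : ∀ {i} → Dec (Earlier i) → Fin k → Fin (k + k)
    tag (yes _) c = k ↑ʳ c
    tag (no _) c = c ↑ˡ k

    resolve : ∀ {i j} → i < j → (dᵢ : Dec (Earlier i)) (dⱼ : Dec (Earlier j)) →
      tag dᵢ (col i) ≡ tag dⱼ (col j) → ∃ (MonochromaticTriple col)
    resolve {i} {j} i<j (yes (h , h<i , ch≡ci)) (yes _) eq =
      triple h i j (<⇒≢ h<i) (<⇒≢ (<-trans h<i i<j)) (<⇒≢ i<j) ,
      sym ch≡ci , trans (sym (↑ʳ-injective k _ _ eq)) (sym ch≡ci)
    resolve _ (yes _) (no _) eq = ⊥-elim (↑ˡ≢↑ʳ _ _ (sym eq))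
    resolve _ (no _) (yes _) eq = ⊥-elim (↑ˡ≢↑ʳ _ _ eq)
    resolve {i} i<j (no _) (no none-earlier) eq = ⊥-elim (none-earlier (i , i<j , ↑ˡ-injective k _ _ eq))

  pigeonhole-triple : k + k ℕ.< n → ∃ (MonochromaticTriple col)
  pigeonhole-triple k+k<n with pigeonhole k+k<n (λ i → tag (earlier? i) (col i))
  ... | i , j , i<j , tags≡ = resolve i<j (earlier? i) (earlier? j) tags≡

-- Systems of orders 1, 6 and 9, checked by evaluation

monochromatic? : (col : Fin n → Fin k) (s : Star3 n) → Dec (Monochromatic col s)
monochromatic? col s =
  (col (leaf₁ s) ≟ col (centre s)) ×-dec (col (leaf₂ s) ≟ col (centre s)) ×-dec (col (leaf₃ s) ≟ col (centre s))

isStarSystem? : ∀ n (B : List (Star3 n)) → Dec (IsStarSystem n B)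
isStarSystem? n B = all? λ u → all? λ v → ¬? (u ≟ v) →-dec (edgeCount B u v ℕ.≟ 1)

proper? : (col : Fin n → Fin k) (B : List (Star3 n)) → Dec (Proper col B)
proper? col = All.all? (¬? ∘ monochromatic? col)

isTriplePartition? : (T : List (Triple n)) → Dec (IsTriplePartition T)
isTriplePartition? T = all? λ w → tripleCount T w ℕ.≟ 1

properTriples? : (col : Fin n → Fin k) (T : List (Triple n)) → Dec (ProperTriples col T)
properTriples? col = All.all? λ t → ¬? ((col (v₂ t) ≟ col (v₁ t)) ×-dec (col (v₃ t) ≟ col (v₁ t)))

mkTriple : (x y z : Fin n) → {True (distinct? x y z)} → Triple n
mkTriple x y z {distinct} = let x≢y , x≢z , y≢z = toWitness distinct in triple x y z x≢y x≢z y≢z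

mkStar : (c : Fin n) (t : Triple n) → {True (¬? (c ∈ₜ? t))} → Star3 n
mkStar c t {c∉t} = cone c t (toWitness c∉t)

decidedSystem : (B : List (Star3 n)) (col : Fin n → Fin k) →
  {True (isStarSystem? n B)} → {True (proper? col B)} → ColouredSystem n k
decidedSystem {n} B col {B-sys} {B-proper} = record
  { stars = B ; isStarSystem = toWitness B-sys ; colouring = col ; proper = toWitness B-proper }

decidedPartitioned : (B : List (Star3 n)) (col : Fin n → Fin k) (T : List (Triple n)) → 3 ∣ n →
  {True (isStarSystem? n B)} → {True (proper? col B)} →
  {True (isTriplePartition? T)} → {True (properTriples? col T)} → PartitionedSystem n k
decidedPartitioned B col T 3∣n {B-sys} {B-proper} {T-part} {T-proper} = record
  { system = decidedSystem B col {B-sys} {B-proper}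
  ; triples = T ; isTriplePartition = toWitness T-part ; triples-proper = toWitness T-proper ; 3∣n = 3∣n }

point : ColouredSystem 1 2
point = decidedSystem [] (λ _ → # 0)

S₆ : PartitionedSystem 6 2
S₆ = decidedPartitioned
  ( mkStar (# 0) (mkTriple (# 1) (# 2) (# 5)) ∷ mkStar (# 1) (mkTriple (# 2) (# 3) (# 5))
  ∷ mkStar (# 2) (mkTriple (# 3) (# 4) (# 5)) ∷ mkStar (# 3) (mkTriple (# 4) (# 0) (# 5))
  ∷ mkStar (# 4) (mkTriple (# 0) (# 1) (# 5)) ∷ [])
  (Vector.fromList (# 0 ∷ # 0 ∷ # 1 ∷ # 0 ∷ # 0 ∷ # 1 ∷ []))
  (mkTriple (# 0) (# 2) (# 3) ∷ mkTriple (# 1) (# 4) (# 5) ∷ [])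
  (divides 2 refl)

S₉ : PartitionedSystem 9 2
S₉ = decidedPartitioned
  ( mkStar (# 0) (mkTriple (# 4) (# 2) (# 3)) ∷ mkStar (# 1) (mkTriple (# 5) (# 4) (# 2))
  ∷ mkStar (# 1) (mkTriple (# 6) (# 0) (# 3)) ∷ mkStar (# 2) (mkTriple (# 7) (# 6) (# 3))
  ∷ mkStar (# 3) (mkTriple (# 8) (# 6) (# 4)) ∷ mkStar (# 4) (mkTriple (# 6) (# 8) (# 2))
  ∷ mkStar (# 5) (mkTriple (# 4) (# 3) (# 0)) ∷ mkStar (# 5) (mkTriple (# 2) (# 8) (# 6))
  ∷ mkStar (# 6) (mkTriple (# 7) (# 0) (# 8)) ∷ mkStar (# 7) (mkTriple (# 0) (# 3) (# 4))
  ∷ mkStar (# 7) (mkTriple (# 5) (# 1) (# 8)) ∷ mkStar (# 8) (mkTriple (# 1) (# 2) (# 0)) ∷ [])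
  (Vector.fromList (# 0 ∷ # 0 ∷ # 0 ∷ # 0 ∷ # 1 ∷ # 0 ∷ # 1 ∷ # 0 ∷ # 1 ∷ []))
  (mkTriple (# 0) (# 1) (# 4) ∷ mkTriple (# 2) (# 3) (# 6) ∷ mkTriple (# 5) (# 7) (# 8) ∷ [])
  (divides 3 refl)

-- Chromatic systems of all large admissible orders

twoColourable : ∀ d → d % 3 ≡ 0 ⊎ d % 3 ≡ 1 → ColouredSystem (6 + d) 2
twoColourable 0 _ = system S₆
twoColourable 1 _ = point ⊕ S₆
twoColourable 2 (inj₁ ())
twoColourable 2 (inj₂ ())
twoColourable 3 _ = system S₉
twoColourable 4 _ = point ⊕ S₉
twoColourable 5 (inj₁ ())
twoColourable 5 (inj₂ ())
-- The residue hypothesis is reused as is: (6 + d) % 3 reduces to d % 3 by evaluation.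
twoColourable (ℕ.suc (ℕ.suc (ℕ.suc (ℕ.suc (ℕ.suc (ℕ.suc d)))))) d%3 =
  subst (λ n → ColouredSystem n 2) (+-comm (6 + d) 6) (twoColourable d d%3 ⊕ S₆)

joinedCopiesOfS₆ : ∀ j → PartitionedSystem (ℕ.suc j ℕ.* 6) 2
joinedCopiesOfS₆ ℕ.zero = S₆
joinedCopiesOfS₆ (ℕ.suc j) = S₆ ⊕ᵖ joinedCopiesOfS₆ j

double<sixfold : ∀ x → ℕ.suc x + ℕ.suc x ℕ.< ℕ.suc x ℕ.* 6
double<sixfold ℕ.zero = s≤s (s≤s (s≤s z≤n))
double<sixfold (ℕ.suc x) rewrite +-suc x (ℕ.suc x) =
  s≤s (s≤s (≤-trans (double<sixfold x) (m≤n+m _ 4)))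

¬colourable-one : ∀ {s} {B : List (Star3 n)} → ¬ Colourable (s ∷ B) 1
¬colourable-one (col , ¬monochromatic ∷ _) = ¬monochromatic (unique _ _ , unique _ _ , unique _ _)
  where
  unique : (i j : Fin 1) → i ≡ j
  unique zero zero = refl

record ChromaticPartitionedSystem (k : ℕ) : Set where
  field
    order : ℕ
    partitioned : PartitionedSystem order (2 + k)
    ¬colourable : ¬ Colourable (stars (system partitioned)) (1 + k)

open ChromaticPartitionedSystem

chromaticPartitioned : ∀ k → ChromaticPartitionedSystem k
chromaticPartitioned ℕ.zero = record
  { partitioned = S₆
  ; ¬colourable = ¬colourable-one
  }
chromaticPartitioned (ℕ.suc k) = record
  { partitioned = extension E
  ; ¬colourable = λ (col , col-proper) →
      let _ , all-triples-proper = forces E col col-proper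
          t , t-monochromatic = pigeonhole-triple (col ∘ embedding E) (double<sixfold (ℕ.suc k))
      in All¬⇒¬Any all-triples-proper (allTriples-monochromatic t t-monochromatic)
  }
  where
  H : ChromaticPartitionedSystem k
  H = chromaticPartitioned k
  open Forcing (partitioned H) (¬colourable H)
  W : PartitionedSystem (ℕ.suc (ℕ.suc k) ℕ.* 6) (3 + k)
  W = recolourᵖ (_↑ˡ ℕ.suc k) (↑ˡ-injective (ℕ.suc k) _ _) (joinedCopiesOfS₆ (ℕ.suc k))
  E : Extension W id (allTriples _)
  E = extend W id id (allTriples _)

ChromaticSystem : ℕ → ℕ → Set
ChromaticSystem k n = Σ (List (Star3 n)) λ B → IsStarSystem n B × Chromatic B k

join-chromatic : ColouredSystem a 2 → (H : ChromaticPartitionedSystem k) → ChromaticSystem (2 + k) (a + order H)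
join-chromatic {a} {k} A H =
  stars S , isStarSystem S , (colouring S , proper S) , ¬colourable-⊕ A′ (partitioned H) (¬colourable H)
  where
  A′ : ColouredSystem a (2 + k)
  A′ = recolour (_↑ˡ k) (↑ˡ-injective k _ _) A
  S : ColouredSystem (a + order H) (2 + k)
  S = A′ ⊕ partitioned H

%3-+-multiple : ∀ m {N} → 3 ∣ N → (m + N) % 3 ≡ m % 3
%3-+-multiple m (divides q refl) = [m+kn]%n≡m%n m q 3

order-split : ∀ {N n} → N + 6 ≤ n → n ≡ (6 + (n ∸ (N + 6))) + N
order-split {N} {n} N+6≤n = begin
  n                          ≡⟨ m+[n∸m]≡n N+6≤n ⟨
  N + 6 + (n ∸ (N + 6))      ≡⟨ +-assoc N 6 _ ⟩
  N + (6 + (n ∸ (N + 6)))    ≡⟨ +-comm N _ ⟩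
  6 + (n ∸ (N + 6)) + N      ∎
  where open ≡-Reasoning

offset-residue : ∀ {N n} → 3 ∣ N → N + 6 ≤ n → n % 3 ≡ 0 ⊎ n % 3 ≡ 1 →
  (n ∸ (N + 6)) % 3 ≡ 0 ⊎ (n ∸ (N + 6)) % 3 ≡ 1
offset-residue {N} {n} 3∣N N+6≤n = Sum.map (trans (sym same)) (trans (sym same))
  where
  same : n % 3 ≡ (n ∸ (N + 6)) % 3
  same = trans (cong (_% 3) (order-split N+6≤n)) (%3-+-multiple (6 + (n ∸ (N + 6))) 3∣N)

corollary2p1 : (k : ℕ) → 2 ≤ k →
    Σ ℕ λ nₖ → (n : ℕ) → nₖ ≤ n → Admissible n →
      Σ (List (Star3 n)) λ B → IsStarSystem n B × Chromatic B k
corollary2p1 (ℕ.suc (ℕ.suc k)) (s≤s (s≤s z≤n)) = order H + 6 , λ n H+6≤n (_ , n%3) →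
  subst (ChromaticSystem (2 + k)) (sym (order-split H+6≤n))
    (join-chromatic (twoColourable _ (offset-residue (3∣n (partitioned H)) H+6≤n n%3)) H)
  where
  H : ChromaticPartitionedSystem k
  H = chromaticPartitioned k
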